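{- Let $\mathcal{I}=\langle m_u\mid u\in P\rangle$ be an order monomial ideal (minimally generated by the $m_u$). Then the geometrical Scarf complex $\Delta^{\mathrm{scarf}}_{\mathcal{I}}$ is a subcomplex of the geometrical order complex $\Delta(P)$.
   Context: $P$ is a finite poset, $m_u$ ($u\in P$) monomials in $\mathbb{K}[x_1,\dots,x_n]$, and the order monomial condition (OM) holds: for any $u,v\in P$ there is an upper bound $w$ of $u,v$ in $P$ with $m_w$ dividing $\mathrm{lcm}(m_u,m_v)$. For $U\subseteq P$, $m_U=\mathrm{lcm}(m_u\mid u\in U)$. The geometrical order complex $\Delta(P)$ is the simplicial complex on $P$ whose faces are the nonempty strictly increasing chains $u_1\lneq\cdots\lneq u_k$. The geometrical Scarf complex is $\Delta^{\mathrm{scarf}}_{\mathcal{I}}=\{U\subseteq P\mid |U|\ge1,\ m_U\neq m_V\text{ for all subsets }V\neq U\}$. -}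

module Defs where

open import Data.Nat using (ℕ; _≤_; _⊔_)
open import Data.Fin using (Fin; zero; suc)
open import Data.Fin.Subset using (Subset; _∈_; Nonempty)
open import Data.Bool using (true; false)
open import Data.Vec using (Vec; []; _∷_; zipWith; replicate)
open import Data.Vec.Relation.Binary.Pointwise.Inductive using (Pointwise)
open import Data.Product using (∃; _×_)
open import Data.Sum using (_⊎_)
open import Relation.Binary.PropositionalEquality using (_≡_)
open import Relation.Nullary using (¬_)
open import Function using (_∘_)

-- A monomial in K[x_1,…,x_n] is represented by its exponent vector.
-- (The coefficient field K plays no role in divisibility / lcm.)
Monomial : ℕ → Set
Monomial n = Vec ℕ n

_∣ₘ_ : ∀ {n} → Monomial n → Monomial n → Set
a ∣ₘ b = Pointwise _≤_ a b

lcmₘ : ∀ {n} → Monomial n → Monomial n → Monomial n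
lcmₘ = zipWith _⊔_

oneₘ : ∀ {n} → Monomial n
oneₘ = replicate _ 0

-- m_U = lcm (m_u | u ∈ U), for U a subset of P = Fin k (lcm of ∅ is 1)
lcmSet : ∀ {k n} → (Fin k → Monomial n) → Subset k → Monomial n
lcmSet {Data.Nat.zero}  m []            = oneₘ
lcmSet {Data.Nat.suc k} m (true ∷ s)  = lcmₘ (m zero) (lcmSet (m ∘ suc) s)
lcmSet {Data.Nat.suc k} m (false ∷ s) = lcmSet (m ∘ suc) s

OM : ∀ {k n} → (Fin k → Fin k → Set) → (Fin k → Monomial n) → Set
OM {k} _≤P_ m = ∀ (u v : Fin k) →
  ∃ λ w → (u ≤P w) × (v ≤P w) × (m w ∣ₘ lcmₘ (m u) (m v))

MinimalGenerators : ∀ {k n} → (Fin k → Monomial n) → Set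
MinimalGenerators {k} m = ∀ (u v : Fin k) → m u ∣ₘ m v → u ≡ v

-- faces of the geometrical order complex Δ(P): nonempty chains
-- (a set of elements that can be listed as u_1 < … < u_r, i.e. pairwise comparable)
IsOrderFace : ∀ {k} → (Fin k → Fin k → Set) → Subset k → Set
IsOrderFace {k} _≤P_ U =
  Nonempty U × (∀ (u v : Fin k) → u ∈ U → v ∈ U → (u ≤P v) ⊎ (v ≤P u))

IsScarfFace : ∀ {k n} → (Fin k → Monomial n) → Subset k → Set
IsScarfFace {k} m U =
  Nonempty U × (∀ (V : Subset k) → ¬ (V ≡ U) → ¬ (lcmSet m U ≡ lcmSet m V))

-- If u, v are incomparable elements of a Scarf face U, the order monomial
-- condition yields w ∉ {u, v} with m_w ∣ lcm(m_u, m_v) ∣ m_{U ∖ {w}}. Then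
-- U ∖ {w} and U ∪ {w} have the same lcm, and one of them is U itself while the
-- other differs from it, contradicting the Scarf condition.
module Submission where

open import Defs
open import Data.Nat using (ℕ; _⊔_)
open import Data.Nat.Properties
  using (≤-trans; ⊔-assoc; ⊔-comm; ⊔-lub; m≤m⊔n; m≤n⊔m; m≤n⇒m⊔n≡n)
open import Data.Fin using (Fin; zero; suc)
open import Data.Fin.Properties using (_≟_)
open import Data.Fin.Subset using (Subset; _∈_; inside; outside)
open import Data.Vec using ([]; _∷_; lookup; _[_]≔_; here; there)
open import Data.Vec.Properties using (zipWith-assoc; zipWith-comm; []≔-lookup; []≔-minimal; lookup∘update)
open import Data.Vec.Relation.Binary.Pointwise.Inductive as Pointwise using ([]; _∷_)
open import Data.Product using (_,_; proj₁)
open import Data.Sum using (_⊎_; inj₁; inj₂)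
open import Data.Empty using (⊥-elim)
open import Relation.Nullary using (¬_; yes; no)
open import Relation.Binary.PropositionalEquality
  using (_≡_; _≢_; refl; sym; trans; cong; cong₂; module ≡-Reasoning)
open import Relation.Binary.Structures using (IsPartialOrder)
open import Function using (_∘_)

private
  variable
    k n : ℕ

∣ₘ-trans : {a b c : Monomial n} → a ∣ₘ b → b ∣ₘ c → a ∣ₘ c
∣ₘ-trans = Pointwise.trans ≤-trans

lcmₘ-upperˡ : (a b : Monomial n) → a ∣ₘ lcmₘ a b
lcmₘ-upperˡ []      []      = []
lcmₘ-upperˡ (x ∷ a) (y ∷ b) = m≤m⊔n x y ∷ lcmₘ-upperˡ a b

lcmₘ-upperʳ : (a b : Monomial n) → b ∣ₘ lcmₘ a b
lcmₘ-upperʳ []      []      = []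
lcmₘ-upperʳ (x ∷ a) (y ∷ b) = m≤n⊔m x y ∷ lcmₘ-upperʳ a b

lcmₘ-least : {a b c : Monomial n} → a ∣ₘ c → b ∣ₘ c → lcmₘ a b ∣ₘ c
lcmₘ-least []       []       = []
lcmₘ-least (p ∷ ps) (q ∷ qs) = ⊔-lub p q ∷ lcmₘ-least ps qs

lcmₘ-absorbˡ : {a b : Monomial n} → a ∣ₘ b → lcmₘ a b ≡ b
lcmₘ-absorbˡ []       = refl
lcmₘ-absorbˡ (p ∷ ps) = cong₂ _∷_ (m≤n⇒m⊔n≡n p) (lcmₘ-absorbˡ ps)

lcmₘ-leftComm : (a b c : Monomial n) → lcmₘ a (lcmₘ b c) ≡ lcmₘ b (lcmₘ a c)
lcmₘ-leftComm a b c = begin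
  lcmₘ a (lcmₘ b c)  ≡⟨ sym (zipWith-assoc ⊔-assoc a b c) ⟩
  lcmₘ (lcmₘ a b) c  ≡⟨ cong (λ d → lcmₘ d c) (zipWith-comm ⊔-comm a b) ⟩
  lcmₘ (lcmₘ b a) c  ≡⟨ zipWith-assoc ⊔-assoc b a c ⟩
  lcmₘ b (lcmₘ a c)  ∎
  where open ≡-Reasoning

lcmSet-upper : (m : Fin k → Monomial n) {S : Subset k} {x : Fin k} →
               x ∈ S → m x ∣ₘ lcmSet m S
lcmSet-upper m {inside  ∷ S} here      = lcmₘ-upperˡ (m zero) (lcmSet (m ∘ suc) S)
lcmSet-upper m {inside  ∷ S} (there p) =
  ∣ₘ-trans (lcmSet-upper (m ∘ suc) p) (lcmₘ-upperʳ (m zero) (lcmSet (m ∘ suc) S))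
lcmSet-upper m {outside ∷ S} (there p) = lcmSet-upper (m ∘ suc) p

lcmSet-insert : (m : Fin k → Monomial n) (S : Subset k) (w : Fin k) →
                lcmSet m (S [ w ]≔ inside) ≡ lcmₘ (m w) (lcmSet m (S [ w ]≔ outside))
lcmSet-insert m (_       ∷ S) zero    = refl
lcmSet-insert m (inside  ∷ S) (suc w) =
  trans (cong (lcmₘ (m zero)) (lcmSet-insert (m ∘ suc) S w)) (lcmₘ-leftComm _ _ _)
lcmSet-insert m (outside ∷ S) (suc w) = lcmSet-insert (m ∘ suc) S w

lcmSet-insert-redundant : (m : Fin k → Monomial n) (S : Subset k) (w : Fin k) →
                          m w ∣ₘ lcmSet m (S [ w ]≔ outside) →
                          lcmSet m (S [ w ]≔ inside) ≡ lcmSet m (S [ w ]≔ outside)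
lcmSet-insert-redundant m S w redundant =
  trans (lcmSet-insert m S w) (lcmₘ-absorbˡ redundant)

[]≔-inside≢[]≔-outside : (S : Subset k) (w : Fin k) → S [ w ]≔ inside ≢ S [ w ]≔ outside
[]≔-inside≢[]≔-outside S w eq with trans (sym (lookup∘update w S inside))
                                         (trans (cong (λ T → lookup T w) eq) (lookup∘update w S outside))
... | ()

∈-[]≔-outside : {S : Subset k} {x w : Fin k} → x ≢ w → x ∈ S → x ∈ (S [ w ]≔ outside)
∈-[]≔-outside {S = S} {x} {w} x≢w = []≔-minimal S x w x≢w

scarfFace-irredundant : {m : Fin k → Monomial n} {U : Subset k} → IsScarfFace m U →
                        (w : Fin k) → ¬ (m w ∣ₘ lcmSet m (U [ w ]≔ outside))
scarfFace-irredundant {m = m} {U} (_ , scarf) w redundant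
  with lookup U w | []≔-lookup U w
... | inside  | U₁≡U = scarf (U [ w ]≔ outside)
                       (λ U₀≡U → []≔-inside≢[]≔-outside U w (trans U₁≡U (sym U₀≡U)))
                       (trans (cong (lcmSet m) (sym U₁≡U)) (lcmSet-insert-redundant m U w redundant))
... | outside | U₀≡U = scarf (U [ w ]≔ inside)
                       (λ U₁≡U → []≔-inside≢[]≔-outside U w (trans U₁≡U (sym U₀≡U)))
                       (trans (cong (lcmSet m) (sym U₀≡U)) (sym (lcmSet-insert-redundant m U w redundant)))

scarfFace-comparable : {_≤P_ : Fin k → Fin k → Set} {m : Fin k → Monomial n} {U : Subset k} →
                       OM _≤P_ m → IsScarfFace m U →
                       {u v : Fin k} → u ∈ U → v ∈ U → (u ≤P v) ⊎ (v ≤P u)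
scarfFace-comparable {m = m} {U} om face {u} {v} u∈U v∈U with om u v
... | w , u≤w , v≤w , mw∣lcm with w ≟ u | w ≟ v
...   | yes refl | _        = inj₂ v≤w
...   | no _     | yes refl = inj₁ u≤w
...   | no w≢u   | no w≢v   = ⊥-elim (scarfFace-irredundant face w
    (∣ₘ-trans mw∣lcm (lcmₘ-least (lcmSet-upper m (∈-[]≔-outside (w≢u ∘ sym) u∈U))
                                  (lcmSet-upper m (∈-[]≔-outside (w≢v ∘ sym) v∈U)))))

lemma6p5 : (k n : ℕ) (_≤P_ : Fin k → Fin k → Set) → IsPartialOrder _≡_ _≤P_ →
    (m : Fin k → Monomial n) → OM _≤P_ m → MinimalGenerators m →
    (U : Subset k) → IsScarfFace m U → IsOrderFace _≤P_ U
lemma6p5 k n _≤P_ _ m om _ U face =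
  proj₁ face , λ u v → scarfFace-comparable om face
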